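{- Let $H$ be a graph and $T\subseteq V(H)$ with $|T|$ odd. Let $G=G(\mathcal{TS}(H,T))$ and $\tilde G=\tilde G(\mathcal{TS}(H,T))$. Then there is a degree-$2$ Nullstellensatz refutation of $\mathsf P_{\mathrm{iso}}(G,\tilde G)$ over $\mathbb F_2$.
   Context: Tseitin CSP $\mathcal{TS}(H,T)$ over $\mathbb Z_2$: there is a variable $z_e$ for every edge $e\in E(H)$. For each vertex $v\in V(H)$, with incident edges $e_1,\dots,e_k$ in some fixed arbitrary order, let $\Delta=\{(i_1,\dots,i_k)\in\mathbb Z_2^k:\sum_j i_j=0\}$; the constraint $C_v$ is $((z_{e_1},\dots,z_{e_k}),R_v)$ with $R_v=\Delta$ if $v\notin T$ and $R_v=\Delta+(1,0,\dots,0)$ if $v\in T$. The coloured graph $G=G(\mathcal{TS}(H,T))$: for each edge $e$ there are vertices $0^{(e)},1^{(e)}$, both with colour $L^{(e)}$; for each vertex $v\in V(H)$ (incident edges $e_1,\dots,e_k$) there are vertices $\beta^{(v)}$ for all $\beta=(\beta_1,\dots,\beta_k)\in R_v$, all with colour $L^{(v)}$, and for each such $\beta$ and $i\in[k]$ an edge $\{\beta^{(v)},\beta_i^{(e_i)}\}$ of colour $M^{(i)}$. The graph $\tilde G=\tilde G(\mathcal{TS}(H,T))$ is defined identically except that $R_v$ is replaced by $\Delta$ for every $v$ (colours $L^{(e)},L^{(v)},M^{(i)}$ are the same as in $G$). Coloured graphs: isomorphisms and local isomorphisms preserve vertex and edge colours. A local isomorphism from $G$ to $\tilde G$ is an injective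 colour-preserving map $\pi$ with domain in $V(G)$ and range in $V(\tilde G)$ (a subset of $V(G)\times V(\tilde G)$) with $vv'\in E(G)\iff\pi(v)\pi(v')\in E(\tilde G)$, edge colours preserved. $\mathsf P_{\mathrm{iso}}(G,\tilde G)$ in variables $x_{vw}$ ($v\in V(G)$, $w\in V(\tilde G)$) consists of: $\sum_{v\in V(G)}x_{vw}-1$ for all $w$; $\sum_{w\in V(\tilde G)}x_{vw}-1$ for all $v$; and $x_{vw}x_{v'w'}$ whenever $\{(v,w),(v',w')\}$ is not a local isomorphism. A degree-$d$ Nullstellensatz refutation of a set $\mathsf P$ of polynomials over a field $\mathbb F$ consists of polynomials $f_p$ ($p\in\mathsf P$) and $g_x$ (for all variables $x$) with $\sum_{p\in\mathsf P}f_pp+\sum_x g_x(x^2-x)=1$, where the degree is the maximum degree of the polynomials $f_pp$. -}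

module Defs where

open import Data.Nat using (ℕ; zero; suc; _≤_; _≡ᵇ_)
open import Data.Bool using (Bool; true; false; not; _xor_; if_then_else_)
import Data.Bool.Properties as BoolP
open import Data.Fin using (Fin; toℕ)
import Data.Fin.Properties as FinP
open import Data.Fin.Subset using (Subset)
open import Data.List using (List; []; _∷_; [_]; _++_; map; concatMap; foldr; filter; length; allFin)
open import Data.Bool.ListAction using (and)
import Data.List.Properties as ListP
open import Data.List.Relation.Unary.All using (All)
open import Data.Product using (Σ; ∃; _×_; _,_; proj₁; proj₂)
open import Data.Sum using (_⊎_)
open import Data.Unit using (⊤)
open import Data.Empty using (⊥)
open import Data.Vec using (lookup)
open import Relation.Nullary using (¬_; yes; no)
open import Relation.Binary using (DecidableEquality)
open import Relation.Binary.PropositionalEquality using (_≡_; _≢_; refl)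
open import Function.Bundles using (_⇔_)
open import Function.Definitions using (Injective)

-- Polynomials over 𝔽₂ (coefficients = Bool, addition = xor) in
-- commuting variables from a type X with decidable equality.
-- A monomial is a list of variables (read as their product; order is
-- irrelevant: monomials are compared as multisets).  A polynomial is
-- a list of monomials (read as their sum over 𝔽₂).

module Poly {X : Set} (_≟X_ : DecidableEquality X) where

  Mono : Set
  Mono = List X

  Pol : Set
  Pol = List Mono

  cnt : X → Mono → ℕ
  cnt x μ = length (filter (x ≟X_) μ)

  monoEq : Mono → Mono → Bool
  monoEq μ ν = and (map (λ x → cnt x μ ≡ᵇ cnt x ν) (μ ++ ν))

  coeff : Pol → Mono → Bool
  coeff p μ = foldr (λ ν b → if monoEq ν μ then not b else b) false p

  _≈P_ : Pol → Pol → Set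
  p ≈P q = ∀ μ → coeff p μ ≡ coeff q μ

  _+P_ : Pol → Pol → Pol
  p +P q = p ++ q

  _*P_ : Pol → Pol → Pol
  p *P q = concatMap (λ μ → map (μ ++_) q) p

  oneP : Pol
  oneP = [ [] ]

  varP : X → Pol
  varP x = [ [ x ] ]

  sumP : List Pol → Pol
  sumP = foldr _+P_ []

  -- x² - x  (= x² + x over 𝔽₂)
  boolAxiom : X → Pol
  boolAxiom x = (x ∷ x ∷ []) ∷ (x ∷ []) ∷ []

  DegLe : ℕ → Pol → Set
  DegLe d p = ∀ μ → coeff p μ ≡ true → length μ ≤ d

  OverVars : (X → Set) → Pol → Set
  OverVars IsVar p = All (All IsVar) p

  -- Degree-d Nullstellensatz refutation over 𝔽₂ of the set of
  -- polynomials {p ∣ InP p}, the variables being {x ∣ IsVar x}.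
  -- Σ_{p∈P} f_p p is given by a finite list of pairs (p , f_p) (terms with
  -- f_p = 0 are omitted), and Σ_x g_x (x²-x) by a finite list of pairs (x , g_x).
  record NSRefutation (IsVar : X → Set) (InP : Pol → Set) (d : ℕ) : Set where
    field
      fs       : List (Pol × Pol)
      gs       : List (X × Pol)
      fs-ok    : All (λ pf → InP (proj₁ pf) × OverVars IsVar (proj₂ pf)
                              × DegLe d (proj₂ pf *P proj₁ pf)) fs
      gs-ok    : All (λ xg → IsVar (proj₁ xg) × OverVars IsVar (proj₂ xg)) gs
      identity : (sumP (map (λ pf → proj₂ pf *P proj₁ pf) fs)
                   +P sumP (map (λ xg → proj₂ xg *P boolAxiom (proj₁ xg)) gs))
                 ≈P oneP

Incident : {n m : ℕ} → (Fin m → Fin n × Fin n) → Fin n → Fin m → Set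
Incident ends v e = proj₁ (ends e) ≡ v ⊎ proj₂ (ends e) ≡ v

IsSimple : {n m : ℕ} → (Fin m → Fin n × Fin n) → Set
IsSimple {n} {m} ends =
  (∀ e → proj₁ (ends e) ≢ proj₂ (ends e)) ×
  (∀ e e' → (ends e ≡ ends e' ⊎ (proj₁ (ends e) ≡ proj₂ (ends e') × proj₂ (ends e) ≡ proj₁ (ends e')))
          → e ≡ e')

-- inc v : Fin (deg v) → Fin m lists the edges incident to v (e₁,…,e_k)
-- in a fixed (arbitrary) order, each exactly once.
IsIncidenceOrder : {n m : ℕ} → (Fin m → Fin n × Fin n) →
                   (deg : Fin n → ℕ) → ((v : Fin n) → Fin (deg v) → Fin m) → Set
IsIncidenceOrder {n} {m} ends deg inc =
  (∀ v → Injective _≡_ _≡_ (inc v)) ×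
  (∀ v e → Incident ends v e ⇔ (∃ λ i → inc v i ≡ e))

parity : List Bool → Bool
parity = foldr _xor_ false

bitAt : List Bool → ℕ → Bool
bitAt []      _       = false
bitAt (b ∷ _) zero    = b
bitAt (_ ∷ β) (suc i) = bitAt β i

allBits : ℕ → List (List Bool)
allBits zero    = [ [] ]
allBits (suc k) = map (true ∷_) (allBits k) ++ map (false ∷_) (allBits k)

-- candidate vertices: b^(e) and β^(v)
data Vtx (n m : ℕ) : Set where
  edgeV : Fin m → Bool → Vtx n m
  consV : Fin n → List Bool → Vtx n m

_≟V_ : {n m : ℕ} → DecidableEquality (Vtx n m)
edgeV e b ≟V edgeV e' b' with e FinP.≟ e' | b BoolP.≟ b'
... | yes refl | yes refl = yes refl
... | no ne    | _        = no λ { refl → ne refl }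
... | yes _    | no ne    = no λ { refl → ne refl }
edgeV _ _ ≟V consV _ _ = no λ ()
consV _ _ ≟V edgeV _ _ = no λ ()
consV v β ≟V consV v' β' with v FinP.≟ v' | ListP.≡-dec BoolP._≟_ β β'
... | yes refl | yes refl = yes refl
... | no ne    | _        = no λ { refl → ne refl }
... | yes _    | no ne    = no λ { refl → ne refl }

_≟VV_ : {n m : ℕ} → DecidableEquality (Vtx n m × Vtx n m)
(a , b) ≟VV (a' , b') with a ≟V a' | b ≟V b'
... | yes refl | yes refl = yes refl
... | no ne    | _        = no λ { refl → ne refl }
... | yes _    | no ne    = no λ { refl → ne refl }

data Colour (n m : ℕ) : Set where
  Le : Fin m → Colour n m
  Lv : Fin n → Colour n m

colour : {n m : ℕ} → Vtx n m → Colour n m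
colour (edgeV e _) = Le e
colour (consV v _) = Lv v

-- The graph is determined by a target vector t : Fin n → Bool, with
-- R_v = {β ∈ 𝔽₂^deg(v) ∣ Σ β = t v}.
-- G : t v = [v ∈ T];   G̃ : t v = false (R_v = Δ).
module Tseitin (n m : ℕ) (deg : Fin n → ℕ) (inc : (v : Fin n) → Fin (deg v) → Fin m) where

  V : Set
  V = Vtx n m

  InR : (Fin n → Bool) → Fin n → List Bool → Set
  InR t v β = length β ≡ deg v × parity β ≡ t v

  InV : (Fin n → Bool) → V → Set
  InV t (edgeV e b) = ⊤
  InV t (consV v β) = InR t v β

  verts : (Fin n → Bool) → List V
  verts t = concatMap (λ e → edgeV e true ∷ edgeV e false ∷ []) (allFin m)
         ++ concatMap (λ v → map (consV v) (filter (λ β → parity β BoolP.≟ t v) (allBits (deg v))))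
                      (allFin n)

  -- edge {β^(v), β_i^(e_i)} of colour M^(i) (colours indexed by i ∈ ℕ)
  Edge₀ : (Fin n → Bool) → ℕ → V → V → Set
  Edge₀ t c (consV v β) (edgeV e b) =
    InR t v β × Σ (Fin (deg v)) (λ i → toℕ i ≡ c × inc v i ≡ e × bitAt β (toℕ i) ≡ b)
  Edge₀ t c _ _ = ⊥

  Edge : (Fin n → Bool) → ℕ → V → V → Set
  Edge t c x y = Edge₀ t c x y ⊎ Edge₀ t c y x

  LocIso : (Fin n → Bool) → (Fin n → Bool) → V → V → V → V → Set
  LocIso t t' x w x' w' =
    (x ≡ x' ⇔ w ≡ w') ×
    colour x ≡ colour w × colour x' ≡ colour w' ×
    (∀ c → Edge t c x x' ⇔ Edge t' c w w')

  open Poly (_≟VV_ {n} {m}) public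

  IsVar : (Fin n → Bool) → (Fin n → Bool) → V × V → Set
  IsVar t t' (v , w) = InV t v × InV t' w

  -- P_iso(G, G̃)  (over 𝔽₂, -1 = +1)
  InPiso : (Fin n → Bool) → (Fin n → Bool) → Pol → Set
  InPiso t t' p =
    (Σ V λ w → InV t' w × p ≡ map (λ v → [ (v , w) ]) (verts t) ++ oneP) ⊎
    (Σ V λ v → InV t v × p ≡ map (λ w → [ (v , w) ]) (verts t') ++ oneP) ⊎
    (Σ V λ v → Σ V λ v' → Σ V λ w → Σ V λ w' →
       InV t v × InV t v' × InV t' w × InV t' w' ×
       ¬ LocIso t t' v w v' w' × p ≡ [ (v , w) ∷ (v' , w') ∷ [] ])

  tG : Subset n → Fin n → Bool
  tG T v = lookup T v

  tG̃ : Fin n → Bool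
  tG̃ _ = false

module Submission where

-- Write x_e for the variable x_{0^(e) 1^(e)}.  Fix a vertex v of degree k, some β ∈ R_v and let
-- B = β^(v).  For γ ∈ Δ, the degree-2 axioms (pairs that are not local isomorphisms) together with the
-- row axiom of 0^(e_i) or the column axiom of 1^(e_i), multiplied by x_{B γ^(v)}, reduce
-- x_{e_i} x_{B γ^(v)} to (β_i + γ_i) x_{B γ^(v)}.  Multiplying the row axiom of B by x_{e_1}, …, x_{e_k}
-- and summing, x_{B γ^(v)} thus collects the coefficient Σ_i (β_i + γ_i) = [v ∈ T]; adding [v ∈ T] times
-- the row axiom of B leaves Σ_i x_{e_i} + [v ∈ T].  Summed over all v every x_e occurs twice, so what
-- remains is |T| = 1.  All multipliers have degree at most 1, hence the refutation has degree 2.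

open import Defs
open import Algebra.Solver.Ring.AlmostCommutativeRing using (fromCommutativeRing)
open import Data.Bool using (Bool; true; false; not; _xor_; _∧_)
import Data.Bool as Bool
import Data.Bool.Properties as BoolP
open import Data.Bool.ListAction using (and)
open import Data.Empty using (⊥-elim)
open import Data.Fin using (Fin; zero; suc; toℕ)
import Data.Fin.Properties as FinP
open import Data.Fin.Subset using (Subset; ∣_∣)
open import Data.List using (List; []; _∷_; [_]; _++_; map; concatMap; filter; length; allFin; replicate)
import Data.List.Properties as ListP
open import Data.List.Relation.Unary.All as All using (All; []; _∷_)
import Data.List.Relation.Unary.All.Properties as AllP
open import Data.Nat using (ℕ; zero; suc; _+_; _≤_; z≤n; s≤s; _%_; _≡ᵇ_)
import Data.Nat.Properties as ℕP
open import Algebra.Properties.CommutativeSemigroup ℕP.+-commutativeSemigroup using (x∙yz≈y∙xz)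
open import Data.Product using (∃₂; _×_; _,_; proj₁; proj₂)
open import Data.Sum using (inj₁; inj₂; [_,_]′)
open import Data.Unit using (tt)
open import Data.Vec using (lookup)
import Data.Vec as Vec
open import Function using (_∘_; case_of_)
open import Function.Bundles using (Equivalence; _⇔_; mk⇔)
import Function.Properties.Equivalence as ⇔
open import Function.Definitions using (Injective)
open import Relation.Binary using (DecidableEquality)
open import Relation.Binary.PropositionalEquality
  using (_≡_; _≢_; _≗_; refl; sym; trans; cong; cong₂; subst; subst₂; module ≡-Reasoning)
open import Relation.Nullary using (¬_; yes; no; does)
open import Relation.Nullary.Decidable using (dec-false; does-⇔; _×-dec_)

open import Algebra.Solver.Ring.Simple (fromCommutativeRing BoolP.xor-∧-commutativeRing) Bool._≟_
  using (solve; con; _:+_; _:*_; _:=_)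

xorSum : {A : Set} → List A → (A → Bool) → Bool
xorSum []      f = false
xorSum (a ∷ L) f = f a xor xorSum L f

infix 4.5 xorSum
syntax xorSum L (λ a → f) = ⨁[ a ∈ L ] f

module _ {A : Set} where

  xorSum-cong : (L : List A) {f g : A → Bool} → (∀ a → f a ≡ g a) → xorSum L f ≡ xorSum L g
  xorSum-cong []      f≗g = refl
  xorSum-cong (a ∷ L) f≗g = cong₂ _xor_ (f≗g a) (xorSum-cong L f≗g)

  xorSum-false : (L : List A) → ⨁[ a ∈ L ] false ≡ false
  xorSum-false []      = refl
  xorSum-false (a ∷ L) = xorSum-false L

  xorSum-++ : (L M : List A) (f : A → Bool) → xorSum (L ++ M) f ≡ xorSum L f xor xorSum M f
  xorSum-++ []      M f = refl
  xorSum-++ (a ∷ L) M f =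
    trans (cong (f a xor_) (xorSum-++ L M f)) (sym (BoolP.xor-assoc (f a) (xorSum L f) (xorSum M f)))

  xorSum-xor : (L : List A) (f g : A → Bool) →
               ⨁[ a ∈ L ] f a xor g a ≡ xorSum L f xor xorSum L g
  xorSum-xor []      f g = refl
  xorSum-xor (a ∷ L) f g =
    trans (cong ((f a xor g a) xor_) (xorSum-xor L f g))
          (solve 4 (λ x y u v → (x :+ y) :+ (u :+ v) := (x :+ u) :+ (y :+ v)) refl
                 (f a) (g a) (xorSum L f) (xorSum L g))

  xorSum-∧ˡ : (L : List A) (b : Bool) (f : A → Bool) → ⨁[ a ∈ L ] b ∧ f a ≡ b ∧ xorSum L f
  xorSum-∧ˡ L false f = xorSum-false L
  xorSum-∧ˡ L true  f = refl

  xorSum-∧ʳ : (L : List A) (b : Bool) (f : A → Bool) → ⨁[ a ∈ L ] f a ∧ b ≡ xorSum L f ∧ b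
  xorSum-∧ʳ L b f = begin
    ⨁[ a ∈ L ] f a ∧ b  ≡⟨ xorSum-cong L (λ a → BoolP.∧-comm (f a) b) ⟩
    ⨁[ a ∈ L ] b ∧ f a  ≡⟨ xorSum-∧ˡ L b f ⟩
    b ∧ xorSum L f      ≡⟨ BoolP.∧-comm b (xorSum L f) ⟩
    xorSum L f ∧ b      ∎
    where open ≡-Reasoning

module _ {A B : Set} where

  xorSum-swap : (L : List A) (M : List B) (f : A → B → Bool) →
                ⨁[ a ∈ L ] xorSum M (f a) ≡ ⨁[ b ∈ M ] ⨁[ a ∈ L ] f a b
  xorSum-swap []      M f = sym (xorSum-false M)
  xorSum-swap (a ∷ L) M f =
    trans (cong (xorSum M (f a) xor_) (xorSum-swap L M f)) (sym (xorSum-xor M (f a) _))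

  xorSum-map : (h : A → B) (L : List A) (f : B → Bool) → xorSum (map h L) f ≡ xorSum L (f ∘ h)
  xorSum-map h []      f = refl
  xorSum-map h (a ∷ L) f = cong (f (h a) xor_) (xorSum-map h L f)

  xorSum-concatMap : (h : A → List B) (L : List A) (f : B → Bool) →
                     xorSum (concatMap h L) f ≡ ⨁[ a ∈ L ] xorSum (h a) f
  xorSum-concatMap h []      f = refl
  xorSum-concatMap h (a ∷ L) f =
    trans (xorSum-++ (h a) (concatMap h L) f) (cong (xorSum (h a) f xor_) (xorSum-concatMap h L f))

xorSum-allFin-suc : (k : ℕ) (f : Fin (suc k) → Bool) →
                    xorSum (allFin (suc k)) f ≡ f zero xor xorSum (allFin k) (f ∘ suc)
xorSum-allFin-suc k f =
  cong (f zero xor_) (trans (cong (λ L → xorSum L f) (sym (ListP.map-tabulate (λ i → i) suc)))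
                            (xorSum-map suc (allFin k) f))

xorSum-allFin-≟ : (k : ℕ) (x : Fin k) → ⨁[ y ∈ allFin k ] does (y FinP.≟ x) ≡ true
xorSum-allFin-≟ (suc k) zero =
  trans (xorSum-allFin-suc k (λ y → does (y FinP.≟ zero))) (cong (true xor_) (xorSum-false (allFin k)))
xorSum-allFin-≟ (suc k) (suc x) =
  trans (xorSum-allFin-suc k (λ y → does (y FinP.≟ suc x))) (xorSum-allFin-≟ k x)

xorSum-allFin-select : (k : ℕ) (f : Fin k → Bool) (x : Fin k) →
                       ⨁[ y ∈ allFin k ] does (y FinP.≟ x) ∧ f y ≡ f x
xorSum-allFin-select k f x = begin
  ⨁[ y ∈ allFin k ] does (y FinP.≟ x) ∧ f y    ≡⟨ xorSum-cong (allFin k) at-x ⟩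
  ⨁[ y ∈ allFin k ] does (y FinP.≟ x) ∧ f x    ≡⟨ xorSum-∧ʳ (allFin k) (f x) (λ y → does (y FinP.≟ x)) ⟩
  (⨁[ y ∈ allFin k ] does (y FinP.≟ x)) ∧ f x  ≡⟨ cong (_∧ f x) (xorSum-allFin-≟ k x) ⟩
  f x                                           ∎
  where
  open ≡-Reasoning
  at-x : ∀ y → does (y FinP.≟ x) ∧ f y ≡ does (y FinP.≟ x) ∧ f x
  at-x y with y FinP.≟ x
  ... | yes refl = refl
  ... | no _     = refl

module _ {A : Set} (_≟_ : DecidableEquality A) {k : ℕ} {f : Fin k → A} (f-inj : Injective _≡_ _≡_ f) where

  xorSum-injective-hit : ∀ {a} i₀ → f i₀ ≡ a → ⨁[ i ∈ allFin k ] does (a ≟ f i) ≡ true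
  xorSum-injective-hit i₀ refl =
    trans (xorSum-cong (allFin k) λ i →
             does-⇔ (mk⇔ (λ eq → f-inj (sym eq)) (cong f ∘ sym)) (f i₀ ≟ f i) (i FinP.≟ i₀))
          (xorSum-allFin-≟ k i₀)

xorSum-miss : {A : Set} (_≟_ : DecidableEquality A) {k : ℕ} (f : Fin k → A) {a : A} →
              (∀ i → f i ≢ a) → ⨁[ i ∈ allFin k ] does (a ≟ f i) ≡ false
xorSum-miss _≟_ {k} f f≢a =
  trans (xorSum-cong (allFin k) (λ i → dec-false (_ ≟ f i) (f≢a i ∘ sym))) (xorSum-false (allFin k))

module _ {n m : ℕ} (ends : Fin m → Fin n × Fin n) {deg : Fin n → ℕ} {inc : (v : Fin n) → Fin (deg v) → Fin m}
         (loopless : ∀ e → proj₁ (ends e) ≢ proj₂ (ends e)) (order : IsIncidenceOrder ends deg inc) where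

  xorSum-incident : ∀ {v e} → Incident ends v e → ⨁[ i ∈ allFin (deg v) ] does (e FinP.≟ inc v i) ≡ true
  xorSum-incident {v} {e} v∈e = let (i₀ , eq) = Equivalence.to (proj₂ order v e) v∈e
                    in xorSum-injective-hit FinP._≟_ (proj₁ order v) i₀ eq

  xorSum-incidences : (v : Fin n) (e : Fin m) →
                      ⨁[ i ∈ allFin (deg v) ] does (e FinP.≟ inc v i)
                        ≡ does (v FinP.≟ proj₁ (ends e)) xor does (v FinP.≟ proj₂ (ends e))
  xorSum-incidences v e with v FinP.≟ proj₁ (ends e) | v FinP.≟ proj₂ (ends e)
  ... | yes p  | yes q  = ⊥-elim (loopless e (trans (sym p) q))
  ... | yes p  | no _   = xorSum-incident (inj₁ (sym p))
  ... | no _   | yes q  = xorSum-incident (inj₂ (sym q))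
  ... | no ¬p  | no ¬q  = xorSum-miss FinP._≟_ (inc v) λ i eq →
    [ ¬p ∘ sym , ¬q ∘ sym ]′ (Equivalence.from (proj₂ order v e) (i , eq))

  handshake : (g : Fin m → Bool) → ⨁[ v ∈ allFin n ] ⨁[ i ∈ allFin (deg v) ] g (inc v i) ≡ false
  handshake g = begin
    ⨁[ v ∈ allFin n ] ⨁[ i ∈ allFin (deg v) ] g (inc v i)
      ≡˘⟨ xorSum-cong (allFin n) (λ v → xorSum-cong (allFin (deg v)) (λ i → xorSum-allFin-select m g (inc v i))) ⟩
    ⨁[ v ∈ allFin n ] ⨁[ i ∈ allFin (deg v) ] ⨁[ e ∈ allFin m ] does (e FinP.≟ inc v i) ∧ g e
      ≡⟨ xorSum-cong (allFin n) (λ v → xorSum-swap (allFin (deg v)) (allFin m) _) ⟩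
    ⨁[ v ∈ allFin n ] ⨁[ e ∈ allFin m ] ⨁[ i ∈ allFin (deg v) ] does (e FinP.≟ inc v i) ∧ g e
      ≡⟨ xorSum-swap (allFin n) (allFin m) _ ⟩
    ⨁[ e ∈ allFin m ] ⨁[ v ∈ allFin n ] ⨁[ i ∈ allFin (deg v) ] does (e FinP.≟ inc v i) ∧ g e
      ≡⟨ xorSum-cong (allFin m) (λ e → trans (xorSum-cong (allFin n) (λ v → xorSum-∧ʳ (allFin (deg v)) (g e) _))
                                             (xorSum-∧ʳ (allFin n) (g e) _)) ⟩
    ⨁[ e ∈ allFin m ] (⨁[ v ∈ allFin n ] ⨁[ i ∈ allFin (deg v) ] does (e FinP.≟ inc v i)) ∧ g e
      ≡⟨ xorSum-cong (allFin m) (λ e → cong (_∧ g e) (edge-counted-twice e)) ⟩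
    ⨁[ e ∈ allFin m ] false
      ≡⟨ xorSum-false (allFin m) ⟩
    false ∎
    where
    open ≡-Reasoning
    edge-counted-twice : ∀ e → ⨁[ v ∈ allFin n ] ⨁[ i ∈ allFin (deg v) ] does (e FinP.≟ inc v i) ≡ false
    edge-counted-twice e =
      trans (xorSum-cong (allFin n) (λ v → xorSum-incidences v e))
            (trans (xorSum-xor (allFin n) _ _)
                   (cong₂ _xor_ (xorSum-allFin-≟ n (proj₁ (ends e))) (xorSum-allFin-≟ n (proj₂ (ends e)))))

odd : ℕ → Bool
odd zero    = false
odd (suc k) = not (odd k)

odd-if-%2≡1 : ∀ k → k % 2 ≡ 1 → odd k ≡ true
odd-if-%2≡1 (suc zero)    _ = refl
odd-if-%2≡1 (suc (suc k)) h = trans (BoolP.not-involutive (odd k)) (odd-if-%2≡1 k h)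

xorSum-lookup : {n : ℕ} (T : Subset n) → ⨁[ v ∈ allFin n ] lookup T v ≡ odd ∣ T ∣
xorSum-lookup Vec.[]           = refl
xorSum-lookup (true Vec.∷ T)  = trans (xorSum-allFin-suc _ (lookup (true Vec.∷ T))) (cong not (xorSum-lookup T))
xorSum-lookup (false Vec.∷ T) = trans (xorSum-allFin-suc _ (lookup (false Vec.∷ T))) (xorSum-lookup T)

≡⇔≡⇒≡-xor : ∀ {x b y c : Bool} → (x ≡ b ⇔ y ≡ c) → c ≡ (b xor x) xor y
≡⇔≡⇒≡-xor {x} {b} {y} {c} x≡b⇔y≡c with x Bool.≟ b | y Bool.≟ c
... | yes refl | yes refl = cong (_xor y) (sym (BoolP.xor-same x))
... | yes x≡b  | no y≢c   = ⊥-elim (y≢c (Equivalence.to x≡b⇔y≡c x≡b))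
... | no x≢b   | yes y≡c  = ⊥-elim (x≢b (Equivalence.from x≡b⇔y≡c y≡c))
... | no x≢b   | no y≢c   =
  trans (BoolP.¬-not (y≢c ∘ sym))
        (cong (_xor y) (sym (trans (cong (_xor x) (BoolP.¬-not (x≢b ∘ sym))) (BoolP.xor-inverseˡ x))))

xorSum-bitAt : ∀ {k} (β : List Bool) → length β ≡ k → ⨁[ i ∈ allFin k ] bitAt β (toℕ i) ≡ parity β
xorSum-bitAt {zero}  []      refl = refl
xorSum-bitAt {suc k} (b ∷ β) len  =
  trans (xorSum-allFin-suc k (λ i → bitAt (b ∷ β) (toℕ i))) (cong (b xor_) (xorSum-bitAt β (ℕP.suc-injective len)))

xorSum-allFin-zero : ∀ {k} → k ≡ 0 → (f : Fin k → Bool) → xorSum (allFin k) f ≡ false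
xorSum-allFin-zero refl f = refl

parity-replicate-false : ∀ k → parity (replicate k false) ≡ false
parity-replicate-false zero    = refl
parity-replicate-false (suc k) = parity-replicate-false k

module PolynomialCalculus {X : Set} (_≟X_ : DecidableEquality X) where
  open Poly _≟X_

  coeff-xorSum : (p : Pol) (μ : Mono) → coeff p μ ≡ ⨁[ ν ∈ p ] monoEq ν μ
  coeff-xorSum []      μ = refl
  coeff-xorSum (ν ∷ p) μ with monoEq ν μ
  ... | true  = cong not (coeff-xorSum p μ)
  ... | false = coeff-xorSum p μ

  coeff-+P : (p q : Pol) (μ : Mono) → coeff (p +P q) μ ≡ coeff p μ xor coeff q μ
  coeff-+P p q μ = begin
    coeff (p ++ q) μ                                     ≡⟨ coeff-xorSum (p ++ q) μ ⟩
    ⨁[ ν ∈ p ++ q ] monoEq ν μ                           ≡⟨ xorSum-++ p q _ ⟩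
    (⨁[ ν ∈ p ] monoEq ν μ) xor (⨁[ ν ∈ q ] monoEq ν μ)
      ≡˘⟨ cong₂ _xor_ (coeff-xorSum p μ) (coeff-xorSum q μ) ⟩
    coeff p μ xor coeff q μ                              ∎
    where open ≡-Reasoning

  coeff-sumP : {A : Set} (h : A → Pol) (L : List A) (μ : Mono) →
               coeff (sumP (map h L)) μ ≡ ⨁[ a ∈ L ] coeff (h a) μ
  coeff-sumP h []      μ = refl
  coeff-sumP h (a ∷ L) μ =
    trans (coeff-+P (h a) (sumP (map h L)) μ) (cong (coeff (h a) μ xor_) (coeff-sumP h L μ))

  coeff-monomial : (ν μ : Mono) → coeff [ ν ] μ ≡ monoEq ν μ
  coeff-monomial ν μ = trans (coeff-xorSum [ ν ] μ) (BoolP.xor-identityʳ _)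

  coeff-monomial-*P : (ν : Mono) (p : Pol) (μ : Mono) → coeff ([ ν ] *P p) μ ≡ ⨁[ ρ ∈ p ] monoEq (ν ++ ρ) μ
  coeff-monomial-*P ν p μ = begin
    coeff (map (ν ++_) p ++ []) μ             ≡⟨ cong (λ q → coeff q μ) (ListP.++-identityʳ (map (ν ++_) p)) ⟩
    coeff (map (ν ++_) p) μ                   ≡⟨ coeff-xorSum (map (ν ++_) p) μ ⟩
    ⨁[ ρ ∈ map (ν ++_) p ] monoEq ρ μ         ≡⟨ xorSum-map (ν ++_) p _ ⟩
    ⨁[ ρ ∈ p ] monoEq (ν ++ ρ) μ              ∎
    where open ≡-Reasoning

  cnt-++ : ∀ x μ ν → cnt x (μ ++ ν) ≡ cnt x μ + cnt x ν
  cnt-++ x μ ν = trans (cong length (ListP.filter-++ (x ≟X_) μ ν)) (ListP.length-++ (filter (x ≟X_) μ))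

  monoEq-swap : ∀ x y μ → monoEq (x ∷ y ∷ []) μ ≡ monoEq (y ∷ x ∷ []) μ
  monoEq-swap x y μ =
    trans (cong and (ListP.map-cong (λ z → cong (_≡ᵇ cnt z μ) (cnt-swap z)) (x ∷ y ∷ μ)))
          (solve 3 (λ a b r → a :* (b :* r) := b :* (a :* r)) refl (test x) (test y) (and (map test μ)))
    where
    cnt-swap : ∀ z → cnt z (x ∷ y ∷ []) ≡ cnt z (y ∷ x ∷ [])
    cnt-swap z = trans (cnt-++ z [ x ] [ y ]) (trans (ℕP.+-comm (cnt z [ x ]) _) (sym (cnt-++ z [ y ] [ x ])))
    test : X → Bool
    test z = cnt z (y ∷ x ∷ []) ≡ᵇ cnt z μ

  split-at : ∀ y ν → 1 ≤ cnt y ν → ∃₂ λ a b → ν ≡ a ++ y ∷ b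
  split-at y (z ∷ ν) y∈ν with y ≟X z
  ... | yes refl = [] , ν , refl
  ... | no _ with split-at y ν y∈ν
  ...   | a , b , refl = z ∷ a , b , refl

  cnt-head : ∀ y μ → cnt y (y ∷ μ) ≡ suc (cnt y μ)
  cnt-head y μ with y ≟X y
  ... | yes _  = refl
  ... | no y≢y = ⊥-elim (y≢y refl)

  length-≤-if-cnt-≤ : ∀ μ ν → All (λ x → cnt x μ ≤ cnt x ν) μ → length μ ≤ length ν
  length-≤-if-cnt-≤ []      ν _ = z≤n
  length-≤-if-cnt-≤ (y ∷ μ) ν (y-ok ∷ μ-ok)
    with split-at y ν (ℕP.≤-trans (s≤s z≤n) (subst (_≤ cnt y ν) (cnt-head y μ) y-ok))
  ... | a , b , refl = begin
    suc (length μ)         ≤⟨ s≤s (length-≤-if-cnt-≤ μ (a ++ b) (All.map drop-y μ-ok)) ⟩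
    suc (length (a ++ b))  ≡⟨ ListP.length-++-sucʳ a y b ⟨
    length (a ++ y ∷ b)    ∎
    where
    open ℕP.≤-Reasoning
    cnt-middle : ∀ x → cnt x (a ++ y ∷ b) ≡ cnt x [ y ] + cnt x (a ++ b)
    cnt-middle x =
      trans (cnt-++ x a (y ∷ b))
      (trans (cong (cnt x a +_) (cnt-++ x [ y ] b))
      (trans (x∙yz≈y∙xz (cnt x a) (cnt x [ y ]) (cnt x b)) (cong (cnt x [ y ] +_) (sym (cnt-++ x a b)))))
    drop-y : ∀ {x} → cnt x (y ∷ μ) ≤ cnt x (a ++ y ∷ b) → cnt x μ ≤ cnt x (a ++ b)
    drop-y {x} le = ℕP.+-cancelˡ-≤ (cnt x [ y ]) _ _
      (subst₂ _≤_ (cnt-++ x [ y ] μ) (cnt-middle x) le)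

  length-≤-if-monoEq : ∀ ν μ → monoEq ν μ ≡ true → length μ ≤ length ν
  length-≤-if-monoEq ν μ ν≈μ =
    length-≤-if-cnt-≤ μ ν (All.map cnt-≤ (AllP.++⁻ʳ ν (AllP.all⁺ _ (ν ++ μ) (subst Bool.T (sym ν≈μ) tt))))
    where
    cnt-≤ : ∀ {x} → Bool.T (cnt x ν ≡ᵇ cnt x μ) → cnt x μ ≤ cnt x ν
    cnt-≤ {x} eq = ℕP.≤-reflexive (sym (ℕP.≡ᵇ⇒≡ (cnt x ν) (cnt x μ) eq))

  DegLe-if-lengths : ∀ d (p : Pol) → All (λ ν → length ν ≤ d) p → DegLe d p
  DegLe-if-lengths d (ν ∷ p) (ν≤d ∷ p≤d) μ coeff≡true with monoEq ν μ in ν≈μ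
  ... | true  = ℕP.≤-trans (length-≤-if-monoEq ν μ ν≈μ) ν≤d
  ... | false = DegLe-if-lengths d p p≤d μ coeff≡true

  module Derivations (IsVar : X → Set) (InP : Pol → Set) (d : ℕ) where

    combination : List (Pol × Pol) → List (X × Pol) → Pol
    combination fs gs = sumP (map (λ pf → proj₂ pf *P proj₁ pf) fs)
                     +P sumP (map (λ xg → proj₂ xg *P boolAxiom (proj₁ xg)) gs)

    -- Polynomials are handled through their coefficient functions; Derivable φ: the polynomial with
    -- coefficients φ is Σ f_p p + Σ g_x (x² - x) under the side conditions of a degree-d refutation.
    record Derivable (φ : Mono → Bool) : Set where
      field
        fs           : List (Pol × Pol)
        gs           : List (X × Pol)
        fs-ok        : All (λ pf → InP (proj₁ pf) × OverVars IsVar (proj₂ pf)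
                                   × DegLe d (proj₂ pf *P proj₁ pf)) fs
        gs-ok        : All (λ xg → IsVar (proj₁ xg) × OverVars IsVar (proj₂ xg)) gs
        coefficients : coeff (combination fs gs) ≗ φ

    refutation : Derivable (monoEq []) → NSRefutation IsVar InP d
    refutation D = record
      { fs = fs ; gs = gs ; fs-ok = fs-ok ; gs-ok = gs-ok
      ; identity = λ μ → trans (coefficients μ) (sym (coeff-monomial [] μ)) }
      where open Derivable D

    coeff-combination : ∀ fs gs μ →
      coeff (combination fs gs) μ ≡ (⨁[ pf ∈ fs ] coeff (proj₂ pf *P proj₁ pf) μ)
                                 xor (⨁[ xg ∈ gs ] coeff (proj₂ xg *P boolAxiom (proj₁ xg)) μ)
    coeff-combination fs gs μ =
      trans (coeff-+P (sumP (map F fs)) (sumP (map G gs)) μ) (cong₂ _xor_ (coeff-sumP F fs μ) (coeff-sumP G gs μ))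
      where
      F : Pol × Pol → Pol
      F pf = proj₂ pf *P proj₁ pf
      G : X × Pol → Pol
      G xg = proj₂ xg *P boolAxiom (proj₁ xg)

    coeff-combination-++ : ∀ fs gs fs' gs' μ →
      coeff (combination (fs ++ fs') (gs ++ gs')) μ ≡ coeff (combination fs gs) μ xor coeff (combination fs' gs') μ
    coeff-combination-++ fs gs fs' gs' μ = begin
      coeff (combination (fs ++ fs') (gs ++ gs')) μ
        ≡⟨ coeff-combination (fs ++ fs') (gs ++ gs') μ ⟩
      xorSum (fs ++ fs') F xor xorSum (gs ++ gs') G
        ≡⟨ cong₂ _xor_ (xorSum-++ fs fs' F) (xorSum-++ gs gs' G) ⟩
      (xorSum fs F xor xorSum fs' F) xor (xorSum gs G xor xorSum gs' G)
        ≡⟨ solve 4 (λ a b c e → (a :+ b) :+ (c :+ e) := (a :+ c) :+ (b :+ e)) refl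
                 (xorSum fs F) (xorSum fs' F) (xorSum gs G) (xorSum gs' G) ⟩
      (xorSum fs F xor xorSum gs G) xor (xorSum fs' F xor xorSum gs' G)
        ≡˘⟨ cong₂ _xor_ (coeff-combination fs gs μ) (coeff-combination fs' gs' μ) ⟩
      coeff (combination fs gs) μ xor coeff (combination fs' gs') μ ∎
      where
      open ≡-Reasoning
      F : Pol × Pol → Bool
      F pf = coeff (proj₂ pf *P proj₁ pf) μ
      G : X × Pol → Bool
      G xg = coeff (proj₂ xg *P boolAxiom (proj₁ xg)) μ

    derivable-zero : Derivable (λ _ → false)
    derivable-zero = record { fs = [] ; gs = [] ; fs-ok = [] ; gs-ok = [] ; coefficients = λ _ → refl }

    derivable-resp : {φ ψ : Mono → Bool} → φ ≗ ψ → Derivable φ → Derivable ψ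
    derivable-resp φ≗ψ D = record
      { fs = fs ; gs = gs ; fs-ok = fs-ok ; gs-ok = gs-ok ; coefficients = λ μ → trans (coefficients μ) (φ≗ψ μ) }
      where open Derivable D

    derivable-xor : {φ ψ : Mono → Bool} → Derivable φ → Derivable ψ → Derivable (λ μ → φ μ xor ψ μ)
    derivable-xor D E = record
      { fs = fs D ++ fs E ; gs = gs D ++ gs E
      ; fs-ok = AllP.++⁺ (fs-ok D) (fs-ok E) ; gs-ok = AllP.++⁺ (gs-ok D) (gs-ok E)
      ; coefficients = λ μ → trans (coeff-combination-++ (fs D) (gs D) (fs E) (gs E) μ)
                                   (cong₂ _xor_ (coefficients D μ) (coefficients E μ)) }
      where open Derivable

    derivable-⨁ : {A : Set} {P : A → Set} (L : List A) → All P L → {φ : A → Mono → Bool} →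
                  (∀ {a} → P a → Derivable (φ a)) → Derivable (λ μ → ⨁[ a ∈ L ] φ a μ)
    derivable-⨁ []      []         D = derivable-zero
    derivable-⨁ (a ∷ L) (pa ∷ pL) D = derivable-xor (D pa) (derivable-⨁ L pL D)

    derivable-scale : {φ : Mono → Bool} (b : Bool) → (b ≡ true → Derivable φ) → Derivable (λ μ → b ∧ φ μ)
    derivable-scale false _ = derivable-zero
    derivable-scale true  D = D refl

    axiom-derivable : (p f : Pol) → InP p → OverVars IsVar f → DegLe d (f *P p) → Derivable (coeff (f *P p))
    axiom-derivable p f p∈P f-ok deg-ok = record
      { fs = [ (p , f) ] ; gs = [] ; fs-ok = (p∈P , f-ok , deg-ok) ∷ [] ; gs-ok = []
      ; coefficients = λ μ → trans (coeff-combination [ (p , f) ] [] μ)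
                                   (trans (BoolP.xor-identityʳ _) (BoolP.xor-identityʳ _)) }

    booleanAxiom-derivable : (x : X) (g : Pol) → IsVar x → OverVars IsVar g → Derivable (coeff (g *P boolAxiom x))
    booleanAxiom-derivable x g x-ok g-ok = record
      { fs = [] ; gs = [ (x , g) ] ; fs-ok = [] ; gs-ok = (x-ok , g-ok) ∷ []
      ; coefficients = λ μ → trans (coeff-combination [] [ (x , g) ] μ) (BoolP.xor-identityʳ _) }

    derivable-⨁-except : {A : Set} (_≟_ : DecidableEquality A) {P : A → Set} (L : List A) → All P L →
                         (a₀ : A) → ⨁[ a ∈ L ] does (a ≟ a₀) ≡ true → {φ : A → Mono → Bool} →
                         (∀ {a} → P a → a ≢ a₀ → Derivable (φ a)) →
                         Derivable (λ μ → (⨁[ a ∈ L ] φ a μ) xor φ a₀ μ)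
    derivable-⨁-except _≟_ {P} L PL a₀ a₀-odd {φ} D = derivable-resp sum (derivable-⨁ L PL term)
      where
      term : ∀ {a} → P a → Derivable (λ μ → φ a μ xor does (a ≟ a₀) ∧ φ a₀ μ)
      term {a} pa with a ≟ a₀
      ... | yes refl = derivable-resp (λ μ → sym (BoolP.xor-same (φ a₀ μ))) derivable-zero
      ... | no a≢a₀  = derivable-resp (λ μ → sym (BoolP.xor-identityʳ (φ a μ))) (D pa a≢a₀)
      sum : ∀ μ → (⨁[ a ∈ L ] φ a μ xor does (a ≟ a₀) ∧ φ a₀ μ) ≡ (⨁[ a ∈ L ] φ a μ) xor φ a₀ μ
      sum μ = trans (xorSum-xor L _ _)
                    (cong (xorSum L (λ a → φ a μ) xor_)
                          (trans (xorSum-∧ʳ L (φ a₀ μ) (λ a → does (a ≟ a₀))) (cong (_∧ φ a₀ μ) a₀-odd)))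

    monomial-times-axiom : (ν : Mono) (p : Pol) → InP p → All IsVar ν →
                           All (λ ρ → length ν + length ρ ≤ d) p →
                           Derivable (λ μ → ⨁[ ρ ∈ p ] monoEq (ν ++ ρ) μ)
    monomial-times-axiom ν p p∈P ν-ok degrees =
      derivable-resp (coeff-monomial-*P ν p)
        (axiom-derivable p [ ν ] p∈P (ν-ok ∷ []) (DegLe-if-lengths d ([ ν ] *P p) lengths))
      where
      lengths : All (λ ρ → length ρ ≤ d) (map (ν ++_) p ++ [])
      lengths = AllP.++⁺ (AllP.map⁺ (All.map (subst (_≤ d) (sym (ListP.length-++ ν))) degrees)) []

module TseitinRefutation {n m : ℕ} (deg : Fin n → ℕ) (inc : (v : Fin n) → Fin (deg v) → Fin m)
                         (t : Fin n → Bool) where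
  open Tseitin n m deg inc
  open PolynomialCalculus (_≟VV_ {n} {m})
  open Derivations (IsVar t tG̃) (InPiso t tG̃) 2

  twist : Fin m → V × V
  twist e = edgeV e false , edgeV e true

  verts-InV : (s : Fin n → Bool) → All (InV s) (verts s)
  verts-InV s = AllP.++⁺ (AllP.concat⁺ (AllP.map⁺ (All.universal (λ _ → tt ∷ tt ∷ []) (allFin m))))
                         (AllP.concat⁺ (AllP.map⁺ (All.universal (λ v → AllP.map⁺ (InR-filtered v)) (allFin n))))
    where
    InR-filtered : ∀ v → All (InR s v) (filter (λ β → parity β Bool.≟ s v) (allBits (deg v)))
    InR-filtered v = All.zipWith (λ (par , len) → len , par)
                       (AllP.all-filter _ (allBits (deg v)) , AllP.filter⁺ _ (length-allBits (deg v)))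
      where
      length-allBits : ∀ k → All (λ β → length β ≡ k) (allBits k)
      length-allBits zero    = refl ∷ []
      length-allBits (suc k) = AllP.++⁺ (AllP.map⁺ (All.map (cong suc) (length-allBits k)))
                                        (AllP.map⁺ (All.map (cong suc) (length-allBits k)))

  xorSum-verts-edgeV : (s : Fin n → Bool) (e : Fin m) (b : Bool) → ⨁[ w ∈ verts s ] does (w ≟V edgeV e b) ≡ true
  xorSum-verts-edgeV s e b = begin
    ⨁[ w ∈ verts s ] does (w ≟V edgeV e b)
      ≡⟨ xorSum-++ (concatMap edgeVs (allFin m)) (concatMap consVs (allFin n)) _ ⟩
    xorSum (concatMap edgeVs (allFin m)) is-eb xor xorSum (concatMap consVs (allFin n)) is-eb
      ≡⟨ cong₂ _xor_ (trans (xorSum-concatMap edgeVs (allFin m) is-eb) (xorSum-cong (allFin m) pair))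
                     (trans (xorSum-concatMap consVs (allFin n) is-eb)
                            (xorSum-cong (allFin n) λ v →
                               trans (xorSum-map (consV v) (R v) is-eb) (xorSum-false (R v)))) ⟩
    (⨁[ e' ∈ allFin m ] does (e' FinP.≟ e)) xor (⨁[ v ∈ allFin n ] false)
      ≡⟨ cong₂ _xor_ (xorSum-allFin-≟ m e) (xorSum-false (allFin n)) ⟩
    true ∎
    where
    open ≡-Reasoning
    edgeVs : Fin m → List V
    edgeVs e' = edgeV e' true ∷ edgeV e' false ∷ []
    R : Fin n → List (List Bool)
    R v = filter (λ β → parity β Bool.≟ s v) (allBits (deg v))
    consVs : Fin n → List V
    consVs v = map (consV v) (R v)
    is-eb : V → Bool
    is-eb w = does (w ≟V edgeV e b)
    is-eb-edgeV : ∀ e' c → is-eb (edgeV e' c) ≡ does (e' FinP.≟ e) ∧ does (c Bool.≟ b)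
    is-eb-edgeV e' c = does-⇔ (mk⇔ (λ { refl → refl , refl }) (λ { (refl , refl) → refl }))
                              (edgeV e' c ≟V edgeV e b) (e' FinP.≟ e ×-dec c Bool.≟ b)
    select-bit : ∀ x b → x ∧ does (true Bool.≟ b) xor (x ∧ does (false Bool.≟ b) xor false) ≡ x
    select-bit false _     = refl
    select-bit true  true  = refl
    select-bit true  false = refl
    pair : ∀ e' → xorSum (edgeVs e') is-eb ≡ does (e' FinP.≟ e)
    pair e' = trans (cong₂ (λ p q → p xor (q xor false)) (is-eb-edgeV e' true) (is-eb-edgeV e' false))
                    (select-bit (does (e' FinP.≟ e)) b)

  clash-derivable : ∀ {a w} → InV t a → InV tG̃ w → colour a ≢ colour w → Derivable (monoEq [ (a , w) ])
  clash-derivable {a} {w} a∈ w∈ a≁w = derivable-resp sum (derivable-xor square boolean)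
    where
    x : V × V
    x = a , w
    -- x² is an axiom because {(a,w),(a,w)} is not a local isomorphism; x² - x is a Boolean axiom.
    square : Derivable (λ μ → ⨁[ ρ ∈ [ x ∷ x ∷ [] ] ] monoEq ρ μ)
    square = monomial-times-axiom [] [ x ∷ x ∷ [] ]
               (inj₂ (inj₂ (a , a , w , w , a∈ , a∈ , w∈ , w∈ , a≁w ∘ proj₁ ∘ proj₂ , refl)))
               [] (ℕP.≤-refl ∷ [])
    boolean : Derivable (coeff ([ [] ] *P boolAxiom x))
    boolean = booleanAxiom-derivable x [ [] ] (a∈ , w∈) ([] ∷ [])
    sum : ∀ μ → (monoEq (x ∷ x ∷ []) μ xor false) xor coeff ([ [] ] *P boolAxiom x) μ ≡ monoEq [ x ] μ
    sum μ = trans (cong ((monoEq (x ∷ x ∷ []) μ xor false) xor_) (coeff-monomial-*P [] (boolAxiom x) μ))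
                  (solve 2 (λ p q → (p :+ con false) :+ (p :+ (q :+ con false)) := q) refl
                         (monoEq (x ∷ x ∷ []) μ) (monoEq [ x ] μ))

  nonLocalIso-derivable : ∀ {a w a' w'} → InV t a → InV tG̃ w → InV t a' → InV tG̃ w' →
                          ¬ LocIso t tG̃ a w a' w' → Derivable (monoEq ((a , w) ∷ (a' , w') ∷ []))
  nonLocalIso-derivable {a} {w} {a'} {w'} a∈ w∈ a'∈ w'∈ ¬iso =
    derivable-resp (λ μ → BoolP.xor-identityʳ _)
      (monomial-times-axiom [] [ (a , w) ∷ (a' , w') ∷ [] ]
        (inj₂ (inj₂ (a , a' , w , w' , a∈ , a'∈ , w∈ , w'∈ , ¬iso , refl))) [] (ℕP.≤-refl ∷ []))

  axiom-lengths : (ν : Mono) → length ν ≤ 1 → (h : V → V × V) (L : List V) →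
                  All (λ ρ → length ν + length ρ ≤ 2) (map (λ w → [ h w ]) L ++ oneP)
  axiom-lengths ν ν≤1 h L =
    AllP.++⁺ (AllP.map⁺ (All.universal (λ _ → ℕP.+-mono-≤ ν≤1 ℕP.≤-refl) L))
             (ℕP.≤-trans (ℕP.≤-reflexive (ℕP.+-identityʳ (length ν))) (ℕP.m≤n⇒m≤1+n ν≤1) ∷ [])

  xorSum-axiom-split : (ν : Mono) (h : V → V × V) (L : List V) (μ : Mono) →
                       ⨁[ ρ ∈ map (λ w → [ h w ]) L ++ oneP ] monoEq (ν ++ ρ) μ
                         ≡ (⨁[ w ∈ L ] monoEq (ν ++ [ h w ]) μ) xor monoEq ν μ
  xorSum-axiom-split ν h L μ =
    trans (xorSum-++ (map (λ w → [ h w ]) L) oneP _)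
          (cong₂ _xor_ (xorSum-map (λ w → [ h w ]) L _)
                       (trans (BoolP.xor-identityʳ _) (cong (λ ν' → monoEq ν' μ) (ListP.++-identityʳ ν))))

  row-axiom-times : (ν : Mono) → All (IsVar t tG̃) ν → length ν ≤ 1 → ∀ {a} → InV t a →
                    Derivable (λ μ → (⨁[ w ∈ verts tG̃ ] monoEq (ν ++ [ (a , w) ]) μ) xor monoEq ν μ)
  row-axiom-times ν ν-ok ν≤1 {a} a∈ =
    derivable-resp (xorSum-axiom-split ν (a ,_) (verts tG̃))
      (monomial-times-axiom ν _ (inj₂ (inj₁ (a , a∈ , refl))) ν-ok (axiom-lengths ν ν≤1 (a ,_) (verts tG̃)))

  column-axiom-times : (ν : Mono) → All (IsVar t tG̃) ν → length ν ≤ 1 → ∀ {w} → InV tG̃ w →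
                       Derivable (λ μ → (⨁[ a ∈ verts t ] monoEq (ν ++ [ (a , w) ]) μ) xor monoEq ν μ)
  column-axiom-times ν ν-ok ν≤1 {w} w∈ =
    derivable-resp (xorSum-axiom-split ν (_, w) (verts t))
      (monomial-times-axiom ν _ (inj₁ (w , w∈ , refl)) ν-ok (axiom-lengths ν ν≤1 (_, w) (verts t)))

  private
    xor-cancel : ∀ s y z → (s xor y) xor (s xor z) ≡ z xor y
    xor-cancel = solve 3 (λ s y z → (s :+ y) :+ (s :+ z) := z :+ y) refl

  row-axiom-times-except : (ν : Mono) → All (IsVar t tG̃) ν → length ν ≤ 1 → ∀ {a} → InV t a →
                           (e : Fin m) (b : Bool) →
                           (∀ {w} → InV tG̃ w → w ≢ edgeV e b → Derivable (monoEq (ν ++ [ (a , w) ]))) →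
                           Derivable (λ μ → monoEq (ν ++ [ (a , edgeV e b) ]) μ xor monoEq ν μ)
  row-axiom-times-except ν ν-ok ν≤1 {a} a∈ e b others =
    derivable-resp (λ μ → xor-cancel (⨁[ w ∈ verts tG̃ ] monoEq (ν ++ [ (a , w) ]) μ) (monoEq ν μ) _)
      (derivable-xor (row-axiom-times ν ν-ok ν≤1 a∈)
                     (derivable-⨁-except _≟V_ (verts tG̃) (verts-InV tG̃) (edgeV e b)
                                         (xorSum-verts-edgeV tG̃ e b) others))

  column-axiom-times-except : (ν : Mono) → All (IsVar t tG̃) ν → length ν ≤ 1 → ∀ {w} → InV tG̃ w →
                              (e : Fin m) (b : Bool) →
                              (∀ {a} → InV t a → a ≢ edgeV e b → Derivable (monoEq (ν ++ [ (a , w) ]))) →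
                              Derivable (λ μ → monoEq (ν ++ [ (edgeV e b , w) ]) μ xor monoEq ν μ)
  column-axiom-times-except ν ν-ok ν≤1 {w} w∈ e b others =
    derivable-resp (λ μ → xor-cancel (⨁[ a ∈ verts t ] monoEq (ν ++ [ (a , w) ]) μ) (monoEq ν μ) _)
      (derivable-xor (column-axiom-times ν ν-ok ν≤1 w∈)
                     (derivable-⨁-except _≟V_ (verts t) (verts-InV t) (edgeV e b)
                                         (xorSum-verts-edgeV t e b) others))

  adjacent⇔bit : ∀ {s v β} → InR s v β → (i : Fin (deg v)) (b : Bool) →
                 Edge s (toℕ i) (consV v β) (edgeV (inc v i) b) ⇔ bitAt β (toℕ i) ≡ b
  adjacent⇔bit {s} {v} {β} β∈R i b = mk⇔ bit (λ β[i]≡b → inj₁ (β∈R , i , refl , refl , β[i]≡b))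
    where
    bit : Edge s (toℕ i) (consV v β) (edgeV (inc v i) b) → bitAt β (toℕ i) ≡ b
    bit (inj₁ (_ , j , j≡i , _ , β[j]≡b)) with FinP.toℕ-injective j≡i
    ... | refl = β[j]≡b

  module ForcedEdgeVertices {v : Fin n} {β γ : List Bool} (β∈R : InR t v β) (γ∈R̃ : InR tG̃ v γ)
                            (i : Fin (deg v)) where

    bits-preserved : ∀ {b c} → LocIso t tG̃ (consV v β) (consV v γ) (edgeV (inc v i) b) (edgeV (inc v i) c) →
                     bitAt β (toℕ i) ≡ b ⇔ bitAt γ (toℕ i) ≡ c
    bits-preserved {b} {c} (_ , _ , _ , edges) =
      ⇔.trans (⇔.sym (adjacent⇔bit {t} {v} {β} β∈R i b))
              (⇔.trans (edges (toℕ i)) (adjacent⇔bit {tG̃} {v} {γ} γ∈R̃ i c))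

    forced-image : ∀ {x y b w} → bitAt β (toℕ i) ≡ x → bitAt γ (toℕ i) ≡ y →
                   LocIso t tG̃ (consV v β) (consV v γ) (edgeV (inc v i) b) w → w ≡ edgeV (inc v i) ((b xor x) xor y)
    forced-image {w = edgeV _ c}  refl refl iso@(_ , _ , refl , _) =
      cong (edgeV (inc v i)) (≡⇔≡⇒≡-xor (bits-preserved iso))
    forced-image {w = consV _ _} _ _ (_ , _ , () , _)

    forced-preimage : ∀ {x y a c} → bitAt β (toℕ i) ≡ x → bitAt γ (toℕ i) ≡ y →
                      LocIso t tG̃ (consV v β) (consV v γ) a (edgeV (inc v i) c) → a ≡ edgeV (inc v i) ((c xor y) xor x)
    forced-preimage {a = edgeV _ b}  refl refl iso@(_ , _ , refl , _) =
      cong (edgeV (inc v i)) (≡⇔≡⇒≡-xor (⇔.sym (bits-preserved iso)))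
    forced-preimage {a = consV _ _} _ _ (_ , _ , () , _)

  vertexPolynomial : Fin n → Mono → Bool
  vertexPolynomial v μ = (⨁[ i ∈ allFin (deg v) ] monoEq [ twist (inc v i) ] μ) xor t v ∧ monoEq [] μ

  module AtVertex {v : Fin n} {β : List Bool} (β∈R : InR t v β) where

    B : V
    B = consV v β

    I : List (Fin (deg v))
    I = allFin (deg v)

    twist-at : Fin (deg v) → V × V
    twist-at i = twist (inc v i)

    module _ (i : Fin (deg v)) {γ : List Bool} (γ∈R̃ : InR tG̃ v γ) where
      private
        open ForcedEdgeVertices {v} {β} {γ} β∈R γ∈R̃ i
        e : Fin m
        e = inc v i
        twist-clash : ∀ {x} → bitAt β (toℕ i) ≡ x → bitAt γ (toℕ i) ≡ x →
                      Derivable (monoEq ((B , consV v γ) ∷ twist e ∷ []))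
        twist-clash {x} β[i] γ[i] = nonLocalIso-derivable β∈R γ∈R̃ tt tt λ iso →
          case trans (forced-image β[i] γ[i] iso) (cong (edgeV e) (BoolP.xor-same x)) of λ ()

      edge-cell : Derivable (λ μ → monoEq ((B , consV v γ) ∷ twist-at i ∷ []) μ
                                   xor (bitAt β (toℕ i) xor bitAt γ (toℕ i)) ∧ monoEq [ (B , consV v γ) ] μ)
      edge-cell with bitAt β (toℕ i) in β[i] | bitAt γ (toℕ i) in γ[i]
      ... | false | false = derivable-resp (λ μ → sym (BoolP.xor-identityʳ _)) (twist-clash β[i] γ[i])
      ... | true  | true  = derivable-resp (λ μ → sym (BoolP.xor-identityʳ _)) (twist-clash β[i] γ[i])
      ... | false | true  =
        row-axiom-times-except [ (B , consV v γ) ] ((β∈R , γ∈R̃) ∷ []) ℕP.≤-refl {edgeV e false} tt e true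
          (λ w∈ w≢1 → nonLocalIso-derivable β∈R γ∈R̃ tt w∈ (w≢1 ∘ forced-image β[i] γ[i]))
      ... | true  | false =
        column-axiom-times-except [ (B , consV v γ) ] ((β∈R , γ∈R̃) ∷ []) ℕP.≤-refl {edgeV e true} tt e false
          (λ a∈ a≢0 → nonLocalIso-derivable β∈R γ∈R̃ a∈ tt (a≢0 ∘ forced-preimage β[i] γ[i]))

    cellPolynomial : V → Mono → Bool
    cellPolynomial w μ = (⨁[ i ∈ I ] monoEq ((B , w) ∷ twist-at i ∷ []) μ) xor t v ∧ monoEq [ (B , w) ] μ

    clashing-cell : ∀ {w} → InV tG̃ w → colour B ≢ colour w → Derivable (cellPolynomial w)
    clashing-cell w∈ B≁w =
      derivable-xor (derivable-⨁ I (All.universal (λ _ → tt) I)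
                       (λ _ → nonLocalIso-derivable β∈R w∈ tt tt (B≁w ∘ proj₁ ∘ proj₂)))
                    (derivable-scale (t v) (λ _ → clash-derivable β∈R w∈ B≁w))

    matching-cell : ∀ {γ} → InR tG̃ v γ → Derivable (cellPolynomial (consV v γ))
    matching-cell {γ} γ∈R̃ =
      derivable-resp charge (derivable-⨁ I (All.universal (λ _ → tt) I) (λ {i} _ → edge-cell i γ∈R̃))
      where
      open ≡-Reasoning
      flips : Fin (deg v) → Bool
      flips i = bitAt β (toℕ i) xor bitAt γ (toℕ i)
      flips-sum : ⨁[ i ∈ I ] flips i ≡ t v
      flips-sum = begin
        ⨁[ i ∈ I ] flips i
          ≡⟨ xorSum-xor I (λ i → bitAt β (toℕ i)) (λ i → bitAt γ (toℕ i)) ⟩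
        (⨁[ i ∈ I ] bitAt β (toℕ i)) xor (⨁[ i ∈ I ] bitAt γ (toℕ i))
          ≡⟨ cong₂ _xor_ (xorSum-bitAt β (proj₁ β∈R)) (xorSum-bitAt γ (proj₁ γ∈R̃)) ⟩
        parity β xor parity γ
          ≡⟨ cong₂ _xor_ (proj₂ β∈R) (proj₂ γ∈R̃) ⟩
        t v xor false
          ≡⟨ BoolP.xor-identityʳ (t v) ⟩
        t v ∎
      charge : ∀ μ → ⨁[ i ∈ I ] monoEq ((B , consV v γ) ∷ twist-at i ∷ []) μ
                                 xor flips i ∧ monoEq [ (B , consV v γ) ] μ
                     ≡ cellPolynomial (consV v γ) μ
      charge μ = begin
        ⨁[ i ∈ I ] P i xor flips i ∧ Y       ≡⟨ xorSum-xor I P (λ i → flips i ∧ Y) ⟩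
        xorSum I P xor (⨁[ i ∈ I ] flips i ∧ Y) ≡⟨ cong (xorSum I P xor_) (xorSum-∧ʳ I Y flips) ⟩
        xorSum I P xor (xorSum I flips) ∧ Y   ≡⟨ cong (λ c → xorSum I P xor c ∧ Y) flips-sum ⟩
        xorSum I P xor t v ∧ Y                ∎
        where
        P : Fin (deg v) → Bool
        P i = monoEq ((B , consV v γ) ∷ twist-at i ∷ []) μ
        Y : Bool
        Y = monoEq [ (B , consV v γ) ] μ

    cell : ∀ {w} → InV tG̃ w → Derivable (cellPolynomial w)
    cell {edgeV _ _}  w∈ = clashing-cell w∈ (λ ())
    cell {consV v' γ} w∈ with v' FinP.≟ v
    ... | yes refl = matching-cell w∈
    ... | no v'≢v  = clashing-cell w∈ (λ { refl → v'≢v refl })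

    vertex-derivable : Derivable (vertexPolynomial v)
    vertex-derivable = derivable-resp assemble (derivable-xor twists (derivable-xor cells charge))
      where
      W : List V
      W = verts tG̃
      S : Fin (deg v) → Mono → Bool
      S i μ = ⨁[ w ∈ W ] monoEq (twist-at i ∷ (B , w) ∷ []) μ
      F : Fin (deg v) → Mono → Bool
      F i = monoEq [ twist-at i ]
      Q : V → Mono → Bool
      Q w = monoEq [ (B , w) ]

      twists : Derivable (λ μ → ⨁[ i ∈ I ] S i μ xor F i μ)
      twists = derivable-⨁ I (All.universal (λ _ → tt) I)
                 (λ {i} _ → row-axiom-times [ twist-at i ] ((tt , tt) ∷ []) ℕP.≤-refl β∈R)
      cells : Derivable (λ μ → ⨁[ w ∈ W ] cellPolynomial w μ)
      cells = derivable-⨁ W (verts-InV tG̃) cell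
      charge : Derivable (λ μ → t v ∧ ((⨁[ w ∈ W ] Q w μ) xor monoEq [] μ))
      charge = derivable-scale (t v) (λ _ → row-axiom-times [] [] z≤n β∈R)

      assemble : ∀ μ → (⨁[ i ∈ I ] S i μ xor F i μ)
                       xor ((⨁[ w ∈ W ] cellPolynomial w μ) xor t v ∧ ((⨁[ w ∈ W ] Q w μ) xor monoEq [] μ))
                       ≡ vertexPolynomial v μ
      assemble μ = begin
        (⨁[ i ∈ I ] S i μ xor F i μ) xor ((⨁[ w ∈ W ] cellPolynomial w μ) xor t v ∧ (ΣQ xor o))
          ≡⟨ cong₂ (λ x y → x xor (y xor t v ∧ (ΣQ xor o)))
                   (xorSum-xor I (λ i → S i μ) (λ i → F i μ))
                   (trans (xorSum-xor W S′ (λ w → t v ∧ Q w μ))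
                          (cong₂ _xor_ swapped (xorSum-∧ˡ W (t v) (λ w → Q w μ)))) ⟩
        (ΣS xor ΣF) xor ((ΣS xor t v ∧ ΣQ) xor t v ∧ (ΣQ xor o))
          ≡⟨ solve 5 (λ s f c q o → (s :+ f) :+ ((s :+ c :* q) :+ c :* (q :+ o)) := f :+ c :* o) refl
                   ΣS ΣF (t v) ΣQ o ⟩
        ΣF xor t v ∧ o ∎
        where
        open ≡-Reasoning
        S′ : V → Bool
        S′ w = ⨁[ i ∈ I ] monoEq ((B , w) ∷ twist-at i ∷ []) μ
        ΣS ΣF ΣQ o : Bool
        ΣS = ⨁[ i ∈ I ] S i μ
        ΣF = ⨁[ i ∈ I ] F i μ
        ΣQ = ⨁[ w ∈ W ] Q w μ
        o  = monoEq [] μ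
        swapped : xorSum W S′ ≡ ΣS
        swapped = trans (sym (xorSum-swap I W (λ i w → monoEq ((B , w) ∷ twist-at i ∷ []) μ)))
                        (xorSum-cong I (λ i → xorSum-cong W (λ w → monoEq-swap (B , w) (twist-at i) μ)))

  isolated-vertex-derivable : ∀ {v} → deg v ≡ 0 → Derivable (vertexPolynomial v)
  isolated-vertex-derivable {v} deg≡0 =
    derivable-resp (λ μ → cong (λ z → z xor t v ∧ monoEq [] μ)
                               (sym (xorSum-allFin-zero deg≡0 (λ i → monoEq [ twist (inc v i) ] μ))))
      (derivable-scale (t v) charged)
    where
    w₀ : V
    w₀ = consV v []
    w₀∈ : InV tG̃ w₀
    w₀∈ = sym deg≡0 , refl
    -- With t v = true, v has no vertices in G, so all terms of the column axiom of w₀ clash.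
    charged : t v ≡ true → Derivable (monoEq [])
    charged tv = derivable-resp cancel
      (derivable-xor (derivable-⨁ (verts t) (verts-InV t) (λ a∈ → clash-derivable a∈ w₀∈ (not-at-v a∈)))
                     (column-axiom-times [] [] z≤n w₀∈))
      where
      not-at-v : ∀ {a} → InV t a → colour a ≢ Lv v
      not-at-v {edgeV _ _}        _          ()
      not-at-v {consV _ []}       (_ , even) refl with trans even tv
      ... | ()
      not-at-v {consV _ (_ ∷ _)} (len , _)  refl = ℕP.1+n≢0 (trans len deg≡0)
      cancel : ∀ μ → let K = ⨁[ a ∈ verts t ] monoEq [ (a , w₀) ] μ in K xor (K xor monoEq [] μ) ≡ monoEq [] μ
      cancel μ = let K = ⨁[ a ∈ verts t ] monoEq [ (a , w₀) ] μ in
        trans (sym (BoolP.xor-assoc K K (monoEq [] μ))) (cong (_xor monoEq [] μ) (BoolP.xor-same K))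

  vertexPolynomial-derivable : ∀ v → Derivable (vertexPolynomial v)
  vertexPolynomial-derivable v = by-degree (deg v) refl
    where
    by-degree : ∀ k → deg v ≡ k → Derivable (vertexPolynomial v)
    by-degree zero    deg≡0   = isolated-vertex-derivable deg≡0
    by-degree (suc k) deg≡1+k = AtVertex.vertex-derivable {v} {t v ∷ replicate k false}
      ( trans (cong suc (ListP.length-replicate k)) (sym deg≡1+k)
      , trans (cong (t v xor_) (parity-replicate-false k)) (BoolP.xor-identityʳ (t v)) )

  refutation-of-odd-charge : (ends : Fin m → Fin n × Fin n) → (∀ e → proj₁ (ends e) ≢ proj₂ (ends e)) →
                             IsIncidenceOrder ends deg inc → ⨁[ v ∈ allFin n ] t v ≡ true →
                             NSRefutation (IsVar t tG̃) (InPiso t tG̃) 2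
  refutation-of-odd-charge ends loopless order odd-charge =
    refutation (derivable-resp total (derivable-⨁ (allFin n) (All.universal (λ _ → tt) (allFin n))
                                                  (λ {v} _ → vertexPolynomial-derivable v)))
    where
    total : ∀ μ → ⨁[ v ∈ allFin n ] vertexPolynomial v μ ≡ monoEq [] μ
    total μ = begin
      ⨁[ v ∈ allFin n ] vertexPolynomial v μ
        ≡⟨ xorSum-xor (allFin n) _ (λ v → t v ∧ monoEq [] μ) ⟩
      (⨁[ v ∈ allFin n ] ⨁[ i ∈ allFin (deg v) ] monoEq [ twist (inc v i) ] μ)
        xor (⨁[ v ∈ allFin n ] t v ∧ monoEq [] μ)
        ≡⟨ cong₂ _xor_ (handshake ends loopless order (λ e → monoEq [ twist e ] μ))
                       (xorSum-∧ʳ (allFin n) (monoEq [] μ) t) ⟩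
      (⨁[ v ∈ allFin n ] t v) ∧ monoEq [] μ
        ≡⟨ cong (_∧ monoEq [] μ) odd-charge ⟩
      monoEq [] μ ∎
      where open ≡-Reasoning

theorem4 : (n m : ℕ) (ends : Fin m → Fin n × Fin n) → IsSimple ends →
           (deg : Fin n → ℕ) (inc : (v : Fin n) → Fin (deg v) → Fin m) →
           IsIncidenceOrder ends deg inc →
           (T : Subset n) → ∣ T ∣ % 2 ≡ 1 →
           Tseitin.NSRefutation n m deg inc
             (Tseitin.IsVar n m deg inc (Tseitin.tG n m deg inc T) (Tseitin.tG̃ n m deg inc))
             (Tseitin.InPiso n m deg inc (Tseitin.tG n m deg inc T) (Tseitin.tG̃ n m deg inc))
             2
theorem4 n m ends (loopless , _) deg inc order T |T|-odd =
  TseitinRefutation.refutation-of-odd-charge deg inc (lookup T) ends loopless order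
    (trans (xorSum-lookup T) (odd-if-%2≡1 ∣ T ∣ |T|-odd))
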